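{- Let $\mathcal{H}$ be a pre-Hilbert category and $X$ an object. Then $\mathrm{ClSub}(X)$ is an orthocomplemented lattice: for all $m\in\mathrm{ClSub}(X)$, $m\wedge m^\perp=0$ and $m\vee m^\perp=1$. Moreover, the cotuple $[m,m^\perp]:M\oplus M^\perp\to X$ is a $\dagger$-iso.
   Context: A $\dagger$-category is a category $\mathcal{H}$ with a functor $\dagger:\mathcal{H}^{\mathrm{op}}\to\mathcal{H}$ that is the identity on objects with $f^{\dagger\dagger}=f$. A morphism $m$ is a $\dagger$-mono if $m^\dagger m=\mathrm{id}$, a $\dagger$-epi if $mm^\dagger=\mathrm{id}$, a $\dagger$-iso if both. A pre-Hilbert category is a $\dagger$-category such that: it has finite $\dagger$-biproducts (finite biproducts, including a zero object $0$, with $\pi^\dagger=\kappa$); it has finite $\dagger$-equalisers (equalisers that are $\dagger$-monos); every $\dagger$-mono is a kernel of some morphism; and it is symmetric $\dagger$-monoidal ($(f\otimes g)^\dagger=f^\dagger\otimes g^\dagger$, coherence isomorphisms $\dagger$-isos). Kernels are chosen to be $\dagger$-monos. A subobject of $X$ is an equivalence class of monos into $X$ (modulo isomorphism of domains commuting with the monos), ordered by factorisation; $\mathrm{ClSub}(X)$ is the poset of subobjects representable by a $\dagger$-mono. Its meet $m\wedge n$ is the pullback of $m$ and $n$; its join $m\vee n$ is the $\dagger$-mono part of the factorisation of $[m,n]:M\oplus N\to X$ as an epi followed by a $\dagger$-mono; $0$ is represented by $0\to X$ and $1$ by $\mathrm{id}_X$. For a $\dagger$-mono $m:M\to X$, $m^\perp=\ker(m^\dagger):M^\perp\to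 X$. -}

module Defs where

open import Level using (Level; _⊔_; suc)
open import Data.Product using (Σ; _×_; _,_; ∃)
open import Relation.Binary.PropositionalEquality using (_≡_)

record Category (o ℓ : Level) : Set (suc (o ⊔ ℓ)) where
  infixr 9 _∘_
  field
    Obj  : Set o
    Hom  : Obj → Obj → Set ℓ
    id   : ∀ {A} → Hom A A
    _∘_  : ∀ {A B C} → Hom B C → Hom A B → Hom A C
    idˡ  : ∀ {A B} (f : Hom A B) → id ∘ f ≡ f
    idʳ  : ∀ {A B} (f : Hom A B) → f ∘ id ≡ f
    assoc : ∀ {A B C D} (h : Hom C D) (g : Hom B C) (f : Hom A B) →
            (h ∘ g) ∘ f ≡ h ∘ (g ∘ f)

record DaggerCategory (o ℓ : Level) : Set (suc (o ⊔ ℓ)) where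
  field
    cat : Category o ℓ
  open Category cat public
  infix 10 _†
  field
    _†     : ∀ {A B} → Hom A B → Hom B A
    †-id   : ∀ {A} → (id {A}) † ≡ id
    †-∘    : ∀ {A B C} (g : Hom B C) (f : Hom A B) → (g ∘ f) † ≡ f † ∘ g †
    †-invol : ∀ {A B} (f : Hom A B) → (f †) † ≡ f

module DaggerNotions {o ℓ} (𝓗 : DaggerCategory o ℓ) where
  open DaggerCategory 𝓗

  IsMono : ∀ {A B} → Hom A B → Set (o ⊔ ℓ)
  IsMono {A} {B} m = ∀ {Z} (f g : Hom Z A) → m ∘ f ≡ m ∘ g → f ≡ g

  IsEpi : ∀ {A B} → Hom A B → Set (o ⊔ ℓ)
  IsEpi {A} {B} e = ∀ {Z} (f g : Hom B Z) → f ∘ e ≡ g ∘ e → f ≡ g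

  IsIso : ∀ {A B} → Hom A B → Set ℓ
  IsIso {A} {B} f = Σ (Hom B A) λ g → (g ∘ f ≡ id) × (f ∘ g ≡ id)

  IsDaggerMono : ∀ {A B} → Hom A B → Set ℓ
  IsDaggerMono m = m † ∘ m ≡ id

  IsDaggerEpi : ∀ {A B} → Hom A B → Set ℓ
  IsDaggerEpi m = m ∘ m † ≡ id

  IsDaggerIso : ∀ {A B} → Hom A B → Set ℓ
  IsDaggerIso m = IsDaggerMono m × IsDaggerEpi m

  IsZeroObject : Obj → Set (o ⊔ ℓ)
  IsZeroObject Z =
    (∀ A → Σ (Hom Z A) λ f → ∀ (g : Hom Z A) → g ≡ f) ×
    (∀ A → Σ (Hom A Z) λ f → ∀ (g : Hom A Z) → g ≡ f)

  IsEqualiser : ∀ {E A B} → Hom E A → Hom A B → Hom A B → Set (o ⊔ ℓ)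
  IsEqualiser {E} {A} {B} e f g =
    (f ∘ e ≡ g ∘ e) ×
    (∀ {Z} (h : Hom Z A) → f ∘ h ≡ g ∘ h →
       Σ (Hom Z E) λ u → (e ∘ u ≡ h) × (∀ (u' : Hom Z E) → e ∘ u' ≡ h → u' ≡ u))

  IsPullback : ∀ {P M N X} → Hom P M → Hom P N → Hom M X → Hom N X → Set (o ⊔ ℓ)
  IsPullback {P} {M} {N} {X} p q m n =
    (m ∘ p ≡ n ∘ q) ×
    (∀ {Z} (a : Hom Z M) (b : Hom Z N) → m ∘ a ≡ n ∘ b →
       Σ (Hom Z P) λ u → (p ∘ u ≡ a) × (q ∘ u ≡ b) ×
         (∀ (u' : Hom Z P) → p ∘ u' ≡ a → q ∘ u' ≡ b → u' ≡ u))

  SameSubobject : ∀ {A B X} → Hom A X → Hom B X → Set ℓ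
  SameSubobject {A} {B} {X} a b = Σ (Hom A B) λ φ → IsIso φ × (b ∘ φ ≡ a)

record PreHilbert (o ℓ : Level) : Set (suc (o ⊔ ℓ)) where
  field
    dagger : DaggerCategory o ℓ
  open DaggerCategory dagger public
  open DaggerNotions dagger public
  infixr 6 _⊕_
  infixr 7 _⊗₀_ _⊗₁_
  field
    𝟘       : Obj
    𝟘-zero  : IsZeroObject 𝟘
  zeroMor : ∀ {A B} → Hom A B
  zeroMor {A} {B} =
    Data.Product.proj₁ (Data.Product.proj₁ 𝟘-zero B) ∘
    Data.Product.proj₁ (Data.Product.proj₂ 𝟘-zero A)
  field
    _⊕_  : Obj → Obj → Obj
    π₁   : ∀ {A B} → Hom (A ⊕ B) A
    π₂   : ∀ {A B} → Hom (A ⊕ B) B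
    κ₁   : ∀ {A B} → Hom A (A ⊕ B)
    κ₂   : ∀ {A B} → Hom B (A ⊕ B)
    ⟨_,_⟩ : ∀ {Z A B} → Hom Z A → Hom Z B → Hom Z (A ⊕ B)
    [_,_] : ∀ {A B Z} → Hom A Z → Hom B Z → Hom (A ⊕ B) Z
    π₁-⟨⟩ : ∀ {Z A B} (f : Hom Z A) (g : Hom Z B) → π₁ ∘ ⟨ f , g ⟩ ≡ f
    π₂-⟨⟩ : ∀ {Z A B} (f : Hom Z A) (g : Hom Z B) → π₂ ∘ ⟨ f , g ⟩ ≡ g
    ⟨⟩-unique : ∀ {Z A B} (f : Hom Z A) (g : Hom Z B) (h : Hom Z (A ⊕ B)) →
                π₁ ∘ h ≡ f → π₂ ∘ h ≡ g → h ≡ ⟨ f , g ⟩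
    []-κ₁ : ∀ {A B Z} (f : Hom A Z) (g : Hom B Z) → [ f , g ] ∘ κ₁ ≡ f
    []-κ₂ : ∀ {A B Z} (f : Hom A Z) (g : Hom B Z) → [ f , g ] ∘ κ₂ ≡ g
    []-unique : ∀ {A B Z} (f : Hom A Z) (g : Hom B Z) (h : Hom (A ⊕ B) Z) →
                h ∘ κ₁ ≡ f → h ∘ κ₂ ≡ g → h ≡ [ f , g ]
    π₁κ₁ : ∀ {A B} → π₁ {A} {B} ∘ κ₁ ≡ id
    π₂κ₂ : ∀ {A B} → π₂ {A} {B} ∘ κ₂ ≡ id
    π₁κ₂ : ∀ {A B} → π₁ {A} {B} ∘ κ₂ ≡ zeroMor
    π₂κ₁ : ∀ {A B} → π₂ {A} {B} ∘ κ₁ ≡ zeroMor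
    π₁† : ∀ {A B} → (π₁ {A} {B}) † ≡ κ₁
    π₂† : ∀ {A B} → (π₂ {A} {B}) † ≡ κ₂
    Eq      : ∀ {A B} → Hom A B → Hom A B → Obj
    eq      : ∀ {A B} (f g : Hom A B) → Hom (Eq f g) A
    eq-equaliser : ∀ {A B} (f g : Hom A B) → IsEqualiser (eq f g) f g
    eq-†mono     : ∀ {A B} (f g : Hom A B) → IsDaggerMono (eq f g)
    †mono-kernel : ∀ {M X} (m : Hom M X) → IsDaggerMono m →
                   Σ Obj λ Y → Σ (Hom X Y) λ f → IsEqualiser m f zeroMor
    _⊗₀_ : Obj → Obj → Obj
    _⊗₁_ : ∀ {A B C D} → Hom A B → Hom C D → Hom (A ⊗₀ C) (B ⊗₀ D)
    ⊗-id : ∀ {A C} → (id {A}) ⊗₁ (id {C}) ≡ id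
    ⊗-∘  : ∀ {A B C D E F} (g : Hom B C) (f : Hom A B) (k : Hom E F) (h : Hom D E) →
           (g ∘ f) ⊗₁ (k ∘ h) ≡ (g ⊗₁ k) ∘ (f ⊗₁ h)
    I    : Obj
    α    : ∀ {A B C} → Hom ((A ⊗₀ B) ⊗₀ C) (A ⊗₀ (B ⊗₀ C))
    λ'   : ∀ {A} → Hom (I ⊗₀ A) A
    ρ    : ∀ {A} → Hom (A ⊗₀ I) A
    σ    : ∀ {A B} → Hom (A ⊗₀ B) (B ⊗₀ A)
    α-nat : ∀ {A A' B B' C C'} (f : Hom A A') (g : Hom B B') (h : Hom C C') →
            α ∘ ((f ⊗₁ g) ⊗₁ h) ≡ (f ⊗₁ (g ⊗₁ h)) ∘ α
    λ-nat : ∀ {A A'} (f : Hom A A') → λ' ∘ (id {I} ⊗₁ f) ≡ f ∘ λ'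
    ρ-nat : ∀ {A A'} (f : Hom A A') → ρ ∘ (f ⊗₁ id {I}) ≡ f ∘ ρ
    σ-nat : ∀ {A A' B B'} (f : Hom A A') (g : Hom B B') →
            σ ∘ (f ⊗₁ g) ≡ (g ⊗₁ f) ∘ σ
    pentagon : ∀ {A B C D} →
      (id {A} ⊗₁ α {B} {C} {D}) ∘ α ∘ (α ⊗₁ id) ≡ α ∘ α
    triangle : ∀ {A B} → (id {A} ⊗₁ λ' {B}) ∘ α ≡ ρ ⊗₁ id
    hexagon : ∀ {A B C} →
      α {B} {C} {A} ∘ σ ∘ α ≡ (id ⊗₁ σ) ∘ α ∘ (σ ⊗₁ id)
    σ-σ : ∀ {A B} → σ {B} {A} ∘ σ ≡ id
    †-⊗ : ∀ {A B C D} (f : Hom A B) (g : Hom C D) → (f ⊗₁ g) † ≡ f † ⊗₁ g †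
    α-†iso : ∀ {A B C} → IsDaggerIso (α {A} {B} {C})
    λ-†iso : ∀ {A} → IsDaggerIso (λ' {A})
    ρ-†iso : ∀ {A} → IsDaggerIso (ρ {A})
    σ-†iso : ∀ {A B} → IsDaggerIso (σ {A} {B})

  Ker : ∀ {A B} → Hom A B → Obj
  Ker f = Eq f zeroMor

  ker : ∀ {A B} (f : Hom A B) → Hom (Ker f) A
  ker f = eq f zeroMor

  _^⊥-obj : ∀ {M X} → Hom M X → Obj
  m ^⊥-obj = Ker (m †)

  _^⊥ : ∀ {M X} (m : Hom M X) → Hom (m ^⊥-obj) X
  m ^⊥ = ker (m †)

-- Write n = m^⊥ and c = [ m , n ]. Since m† n = 0, a common restriction m a = n b forces
-- a = m† m a = m† n b = 0 (and likewise b = 0), so m ∧ n = 0, and the same orthogonality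
-- makes c a †-mono. Being a †-mono, c is the kernel of some f; then f m = f n = 0, and
-- f n = 0 gives f = 0 because f† factors through n = ker m† as n u with u = n† f† = (f n)† = 0.
-- So c is the kernel of 0, hence split epi, hence (as a †-mono) a †-iso. Finally any †-mono d
-- with d e = c is split epi via e c†, so it is a †-iso representing the top subobject.
module Submission where

open import Defs
open import Data.Product using (Σ; _×_; _,_; proj₁; proj₂)
open import Relation.Binary.PropositionalEquality
  using (_≡_; refl; sym; trans; cong; cong₂; module ≡-Reasoning)

module DaggerMonoProperties {o ℓ} (𝓒 : DaggerCategory o ℓ) where
  open DaggerCategory 𝓒
  open DaggerNotions 𝓒
  open ≡-Reasoning

  †-swap : ∀ {A B C} (f : Hom A B) (g : Hom C B) → (f † ∘ g) † ≡ g † ∘ f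
  †-swap f g = trans (†-∘ (f †) g) (cong (g † ∘_) (†-invol f))

  †-flip : ∀ {A B} {f : Hom A B} {g : Hom B A} → f † ≡ g → f ≡ g †
  †-flip {f = f} f†≡g = trans (sym (†-invol f)) (cong _† f†≡g)

  †mono-cancelˡ : ∀ {A M X} {m : Hom M X} → IsDaggerMono m → (f : Hom A M) → m † ∘ (m ∘ f) ≡ f
  †mono-cancelˡ {m = m} dm f = begin
    m † ∘ (m ∘ f)  ≡⟨ sym (assoc (m †) m f) ⟩
    (m † ∘ m) ∘ f  ≡⟨ cong (_∘ f) dm ⟩
    id ∘ f         ≡⟨ idˡ f ⟩
    f              ∎

  split-†mono⇒†epi : ∀ {M X} {m : Hom M X} (s : Hom X M) →
                     IsDaggerMono m → m ∘ s ≡ id → IsDaggerEpi m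
  split-†mono⇒†epi {m = m} s dm ms = begin
    m ∘ m †              ≡⟨ cong (m ∘_) (sym (idʳ (m †))) ⟩
    m ∘ (m † ∘ id)       ≡⟨ cong (λ z → m ∘ (m † ∘ z)) (sym ms) ⟩
    m ∘ (m † ∘ (m ∘ s))  ≡⟨ cong (m ∘_) (†mono-cancelˡ dm s) ⟩
    m ∘ s                ≡⟨ ms ⟩
    id                   ∎

  †mono-factor-of-†epi⇒†epi : ∀ {A D X} {d : Hom D X} {c : Hom A X} (e : Hom A D) →
                              IsDaggerMono d → IsDaggerEpi c → d ∘ e ≡ c → IsDaggerEpi d
  †mono-factor-of-†epi⇒†epi {d = d} {c} e dd dc de =
    split-†mono⇒†epi (e ∘ c †) dd (trans (sym (assoc d e (c †))) (trans (cong (_∘ c †) de) dc))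

  †iso⇒sameSubobject-id : ∀ {D X} {d : Hom D X} → IsDaggerIso d → SameSubobject d (id {X})
  †iso⇒sameSubobject-id {d = d} (dd , dd†) = d , (d † , dd , dd†) , idˡ d

module PreHilbertProperties {o ℓ} (𝓗 : PreHilbert o ℓ) where
  open PreHilbert 𝓗
  open DaggerMonoProperties dagger
  open ≡-Reasoning

  ! : ∀ A → Hom A 𝟘
  ! A = proj₁ (proj₂ 𝟘-zero A)

  !-unique : ∀ {A} (g : Hom A 𝟘) → g ≡ ! A
  !-unique {A} = proj₂ (proj₂ 𝟘-zero A)

  ¡ : ∀ A → Hom 𝟘 A
  ¡ A = proj₁ (proj₁ 𝟘-zero A)

  ¡-unique : ∀ {A} (g : Hom 𝟘 A) → g ≡ ¡ A
  ¡-unique {A} = proj₂ (proj₁ 𝟘-zero A)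

  zero-∘ : ∀ {A B C} (f : Hom A B) → zeroMor {B} {C} ∘ f ≡ zeroMor
  zero-∘ {A} {B} {C} f = trans (assoc (¡ C) (! B) f) (cong (¡ C ∘_) (!-unique (! B ∘ f)))

  ∘-zero : ∀ {A B C} (f : Hom B C) → f ∘ zeroMor {A} {B} ≡ zeroMor
  ∘-zero {A} {B} {C} f = trans (sym (assoc f (¡ B) (! A))) (cong (_∘ ! A) (¡-unique (f ∘ ¡ B)))

  zero-† : ∀ {A B} → (zeroMor {A} {B}) † ≡ zeroMor
  zero-† {A} {B} = trans (†-∘ (¡ B) (! A)) (cong₂ _∘_ (¡-unique _) (!-unique _))

  kernel-∘ : ∀ {K A B} {k : Hom K A} {f : Hom A B} → IsEqualiser k f zeroMor → f ∘ k ≡ zeroMor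
  kernel-∘ {k = k} (fk , _) = trans fk (zero-∘ k)

  kernel-of-zero-split : ∀ {K A B} {k : Hom K A} {f : Hom A B} →
                         IsEqualiser k f zeroMor → f ≡ zeroMor → Σ (Hom A K) λ s → k ∘ s ≡ id
  kernel-of-zero-split (_ , univ) f≡0 = let (s , ks , _) = univ id (cong (_∘ id) f≡0) in s , ks

  id≡zero⇒sameSubobject-zero : ∀ {P X} (a : Hom P X) → id {P} ≡ zeroMor →
                               SameSubobject a (zeroMor {𝟘} {X})
  id≡zero⇒sameSubobject-zero {P} a id≡0 = ! P , (¡ P , sym id≡0 , !-unique-id) , zero≡a
    where
      !-unique-id : ! P ∘ ¡ P ≡ id
      !-unique-id = trans (!-unique (! P ∘ ¡ P)) (sym (!-unique id))

      zero≡a : zeroMor ∘ ! P ≡ a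
      zero≡a = begin
        zeroMor ∘ ! P  ≡⟨ zero-∘ (! P) ⟩
        zeroMor        ≡⟨ sym (∘-zero a) ⟩
        a ∘ zeroMor    ≡⟨ cong (a ∘_) (sym id≡0) ⟩
        a ∘ id         ≡⟨ idʳ a ⟩
        a              ∎

  κ-jointly-epi : ∀ {Z A B} (h k : Hom (A ⊕ B) Z) → h ∘ κ₁ ≡ k ∘ κ₁ → h ∘ κ₂ ≡ k ∘ κ₂ → h ≡ k
  κ-jointly-epi h k p q = trans ([]-unique (k ∘ κ₁) (k ∘ κ₂) h p q) (sym ([]-unique _ _ k refl refl))

  ⟨⟩-∘ : ∀ {W Z A B} (f : Hom Z A) (g : Hom Z B) (h : Hom W Z) → ⟨ f , g ⟩ ∘ h ≡ ⟨ f ∘ h , g ∘ h ⟩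
  ⟨⟩-∘ f g h = ⟨⟩-unique _ _ _
    (trans (sym (assoc π₁ ⟨ f , g ⟩ h)) (cong (_∘ h) (π₁-⟨⟩ f g)))
    (trans (sym (assoc π₂ ⟨ f , g ⟩ h)) (cong (_∘ h) (π₂-⟨⟩ f g)))

  κ₁≡⟨id,0⟩ : ∀ {A B} → κ₁ {A} {B} ≡ ⟨ id , zeroMor ⟩
  κ₁≡⟨id,0⟩ = ⟨⟩-unique id zeroMor κ₁ π₁κ₁ π₂κ₁

  κ₂≡⟨0,id⟩ : ∀ {A B} → κ₂ {A} {B} ≡ ⟨ zeroMor , id ⟩
  κ₂≡⟨0,id⟩ = ⟨⟩-unique zeroMor id κ₂ π₁κ₂ π₂κ₂

  []-† : ∀ {A B Z} (f : Hom A Z) (g : Hom B Z) → [ f , g ] † ≡ ⟨ f † , g † ⟩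
  []-† f g = ⟨⟩-unique _ _ _ (component (†-flip π₁†) ([]-κ₁ f g)) (component (†-flip π₂†) ([]-κ₂ f g))
    where
      component : ∀ {C} {π : Hom _ C} {κ : Hom C _} {h : Hom C _} →
                  π ≡ κ † → [ f , g ] ∘ κ ≡ h → π ∘ [ f , g ] † ≡ h †
      component {π = π} {κ} {h} π≡ cκ = begin
        π ∘ [ f , g ] †    ≡⟨ cong (_∘ [ f , g ] †) π≡ ⟩
        κ † ∘ [ f , g ] †  ≡⟨ sym (†-∘ [ f , g ] κ) ⟩
        ([ f , g ] ∘ κ) †  ≡⟨ cong _† cκ ⟩
        h †                ∎

  Orthogonal : ∀ {M N X} → Hom M X → Hom N X → Set ℓ
  Orthogonal m n = m † ∘ n ≡ zeroMor

  orthogonal-sym : ∀ {M N X} {m : Hom M X} {n : Hom N X} → Orthogonal m n → Orthogonal n m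
  orthogonal-sym {m = m} {n} m⊥n = trans (sym (†-swap m n)) (trans (cong _† m⊥n) zero-†)

  ^⊥-orthogonal : ∀ {M X} (m : Hom M X) → Orthogonal m (m ^⊥)
  ^⊥-orthogonal m = kernel-∘ (eq-equaliser (m †) zeroMor)

  ^⊥-†mono : ∀ {M X} (m : Hom M X) → IsDaggerMono (m ^⊥)
  ^⊥-†mono m = eq-†mono (m †) zeroMor

  orthogonal-common-restriction : ∀ {Z M N X} {m : Hom M X} {n : Hom N X} →
    IsDaggerMono m → Orthogonal m n → (a : Hom Z M) (b : Hom Z N) → m ∘ a ≡ n ∘ b → a ≡ zeroMor
  orthogonal-common-restriction {m = m} {n} dm m⊥n a b ma≡nb = begin
    a              ≡⟨ sym (†mono-cancelˡ dm a) ⟩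
    m † ∘ (m ∘ a)  ≡⟨ cong (m † ∘_) ma≡nb ⟩
    m † ∘ (n ∘ b)  ≡⟨ sym (assoc (m †) n b) ⟩
    (m † ∘ n) ∘ b  ≡⟨ cong (_∘ b) m⊥n ⟩
    zeroMor ∘ b    ≡⟨ zero-∘ b ⟩
    zeroMor        ∎

  orthogonal-zero-pullback : ∀ {M N X} {m : Hom M X} {n : Hom N X} →
    IsDaggerMono m → IsDaggerMono n → Orthogonal m n → IsPullback (¡ M) (¡ N) m n
  orthogonal-zero-pullback {m = m} {n} dm dn m⊥n =
    trans (¡-unique (m ∘ ¡ _)) (sym (¡-unique (n ∘ ¡ _))) ,
    λ {Z} a b ma≡nb →
      ! Z ,
      sym (orthogonal-common-restriction dm m⊥n a b ma≡nb) ,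
      sym (orthogonal-common-restriction dn (orthogonal-sym m⊥n) b a (sym ma≡nb)) ,
      λ u _ _ → !-unique u

  orthogonal-pullback-id≡zero : ∀ {P M N X} {m : Hom M X} {n : Hom N X} {p : Hom P M} {q : Hom P N} →
    IsDaggerMono m → IsDaggerMono n → Orthogonal m n → IsPullback p q m n → id {P} ≡ zeroMor
  orthogonal-pullback-id≡zero {p = p} {q} dm dn m⊥n (mp≡nq , univ) =
    trans (unique id (idʳ p) (idʳ q)) (sym (unique zeroMor (through-zero p p≡0) (through-zero q q≡0)))
    where
      p≡0 = orthogonal-common-restriction dm m⊥n p q mp≡nq
      q≡0 = orthogonal-common-restriction dn (orthogonal-sym m⊥n) q p (sym mp≡nq)
      unique = proj₂ (proj₂ (proj₂ (univ p q mp≡nq)))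

      through-zero : ∀ {C} (f : Hom _ C) → f ≡ zeroMor → f ∘ zeroMor ≡ f
      through-zero f f≡0 = trans (∘-zero f) (sym f≡0)

  orthogonal-cotuple-†mono : ∀ {M N X} {m : Hom M X} {n : Hom N X} →
    IsDaggerMono m → IsDaggerMono n → Orthogonal m n → IsDaggerMono [ m , n ]
  orthogonal-cotuple-†mono {m = m} {n} dm dn m⊥n = κ-jointly-epi _ _
    (column κ₁ m ([]-κ₁ m n) dm (orthogonal-sym m⊥n) κ₁≡⟨id,0⟩)
    (column κ₂ n ([]-κ₂ m n) m⊥n dn κ₂≡⟨0,id⟩)
    where
      column : ∀ {A} (κ : Hom A _) (h : Hom A _) → [ m , n ] ∘ κ ≡ h →
               ∀ {x y} → m † ∘ h ≡ x → n † ∘ h ≡ y → κ ≡ ⟨ x , y ⟩ →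
               ([ m , n ] † ∘ [ m , n ]) ∘ κ ≡ id ∘ κ
      column κ h cκ {x} {y} mh nh κ≡ = begin
        ([ m , n ] † ∘ [ m , n ]) ∘ κ  ≡⟨ assoc _ _ κ ⟩
        [ m , n ] † ∘ ([ m , n ] ∘ κ)  ≡⟨ cong ([ m , n ] † ∘_) cκ ⟩
        [ m , n ] † ∘ h                ≡⟨ cong (_∘ h) ([]-† m n) ⟩
        ⟨ m † , n † ⟩ ∘ h              ≡⟨ ⟨⟩-∘ (m †) (n †) h ⟩
        ⟨ m † ∘ h , n † ∘ h ⟩          ≡⟨ cong₂ ⟨_,_⟩ mh nh ⟩
        ⟨ x , y ⟩                      ≡⟨ sym κ≡ ⟩
        κ                              ≡⟨ sym (idˡ κ) ⟩
        id ∘ κ                         ∎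

  annihilates-m-and-^⊥⇒zero : ∀ {M X Y} (m : Hom M X) (f : Hom X Y) →
    f ∘ m ≡ zeroMor → f ∘ m ^⊥ ≡ zeroMor → f ≡ zeroMor
  annihilates-m-and-^⊥⇒zero {Y = Y} m f fm≡0 fn≡0 = begin
    f                ≡⟨ sym (†-invol f) ⟩
    f † †            ≡⟨ cong _† (sym nu≡f†) ⟩
    (n ∘ u) †        ≡⟨ cong (λ z → (n ∘ z) †) u≡0 ⟩
    (n ∘ zeroMor) †  ≡⟨ cong _† (∘-zero n) ⟩
    zeroMor †        ≡⟨ zero-† ⟩
    zeroMor          ∎
    where
      n = m ^⊥
      m†f†≡0 : m † ∘ f † ≡ zeroMor ∘ f †
      m†f†≡0 = trans (sym (†-∘ f m)) (trans (cong _† fm≡0) (trans zero-† (sym (zero-∘ (f †)))))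
      factorisation = proj₂ (eq-equaliser (m †) zeroMor) (f †) m†f†≡0
      u : Hom Y (m ^⊥-obj)
      u = proj₁ factorisation
      nu≡f† : n ∘ u ≡ f †
      nu≡f† = proj₁ (proj₂ factorisation)
      u≡0 : u ≡ zeroMor
      u≡0 = begin
        u              ≡⟨ sym (†mono-cancelˡ (^⊥-†mono m) u) ⟩
        n † ∘ (n ∘ u)  ≡⟨ cong (n † ∘_) nu≡f† ⟩
        n † ∘ f †      ≡⟨ sym (†-∘ f n) ⟩
        (f ∘ n) †      ≡⟨ cong _† fn≡0 ⟩
        zeroMor †      ≡⟨ zero-† ⟩
        zeroMor        ∎

  cotuple-^⊥-†iso : ∀ {M X} {m : Hom M X} → IsDaggerMono m → IsDaggerIso [ m , m ^⊥ ]
  cotuple-^⊥-†iso {m = m} dm = dc , split-†mono⇒†epi s dc cs≡id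
    where
      c = [ m , m ^⊥ ]
      dc = orthogonal-cotuple-†mono dm (^⊥-†mono m) (^⊥-orthogonal m)
      kernel = proj₂ (proj₂ (†mono-kernel c dc))
      f = proj₁ (proj₂ (†mono-kernel c dc))

      f∘c∘κ≡0 : ∀ {A} (κ : Hom A _) → f ∘ (c ∘ κ) ≡ zeroMor
      f∘c∘κ≡0 κ = trans (sym (assoc f c κ)) (trans (cong (_∘ κ) (kernel-∘ kernel)) (zero-∘ κ))

      f≡0 : f ≡ zeroMor
      f≡0 = annihilates-m-and-^⊥⇒zero m f
        (trans (cong (f ∘_) (sym ([]-κ₁ m (m ^⊥)))) (f∘c∘κ≡0 κ₁))
        (trans (cong (f ∘_) (sym ([]-κ₂ m (m ^⊥)))) (f∘c∘κ≡0 κ₂))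

      s = proj₁ (kernel-of-zero-split kernel f≡0)
      cs≡id = proj₂ (kernel-of-zero-split kernel f≡0)

lemma8 : ∀ {o ℓ} (𝓗 : PreHilbert o ℓ) → let open PreHilbert 𝓗 in
    ∀ (X M : Obj) (m : Hom M X) → IsDaggerMono m →
      ((Σ Obj λ P → Σ (Hom P M) λ p → Σ (Hom P (m ^⊥-obj)) λ q →
          IsPullback p q m (m ^⊥))
       × (∀ (P : Obj) (p : Hom P M) (q : Hom P (m ^⊥-obj)) →
          IsPullback p q m (m ^⊥) →
          SameSubobject (m ∘ p) (zeroMor {𝟘} {X})))
      × (∀ (D : Obj) (e : Hom (M ⊕ m ^⊥-obj) D) (d : Hom D X) →
          IsEpi e → IsDaggerMono d → d ∘ e ≡ [ m , m ^⊥ ] →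
          SameSubobject d (id {X}))
      × IsDaggerIso [ m , m ^⊥ ]
lemma8 𝓗 X M m dm = (meet , meet≡0) , join≡1 , c-†iso
  where
    open PreHilbert 𝓗
    open DaggerMonoProperties dagger
    open PreHilbertProperties 𝓗

    dn = ^⊥-†mono m
    m⊥n = ^⊥-orthogonal m
    c-†iso = cotuple-^⊥-†iso dm

    meet = 𝟘 , ¡ M , ¡ (m ^⊥-obj) , orthogonal-zero-pullback dm dn m⊥n

    meet≡0 = λ P p q pb → id≡zero⇒sameSubobject-zero (m ∘ p) (orthogonal-pullback-id≡zero dm dn m⊥n pb)

    join≡1 = λ D e d _ dd de≡c →
      †iso⇒sameSubobject-id (dd , †mono-factor-of-†epi⇒†epi e dd (proj₂ c-†iso) de≡c)
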